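{- Let $\mathbf{e}$ be a transitive relation on a set $E$, and suppose there are pairwise distinct elements $a_0,a_1,b\in E$ such that $a_0\equiv a_1$ and either $b\lhd a_0$ or $a_0\lhd b$. Then there are clopen subsets $\mathbf{a}_0,\mathbf{a}_1,\mathbf{c}$ of $\mathbf{e}$ such that $\mathbf{a}_0\wedge\mathbf{c}=\mathbf{a}_1\wedge\mathbf{c}=\varnothing$ (meets computed in $\mathrm{Reg}(\mathbf{e})$) while $\varnothing\neq\mathbf{c}\subseteq\mathbf{a}_0\vee\mathbf{a}_1$. In particular, the lattice $\mathrm{Reg}(\mathbf{e})$ is neither meet-semidistributive nor pseudocomplemented.
   Context: A transitive relation $\mathbf{e}$ on $E$ is viewed as a set of ordered pairs. Write $x\lhd y$ if $(x,y)\in\mathbf{e}$, $x\unlhd y$ if ($x\lhd y$ or $x=y$), and $x\equiv y$ if ($x\unlhd y$ and $y\unlhd x$). A subset $\mathbf{a}\subseteq\mathbf{e}$ is closed if it is transitive, open if $\mathbf{e}\setminus\mathbf{a}$ is transitive, and clopen if both. $\mathrm{cl}(\mathbf{a})$ denotes the transitive closure of $\mathbf{a}$, and $\mathrm{int}(\mathbf{a})$ the largest open subset of $\mathbf{a}$. A subset $\mathbf{a}\subseteq\mathbf{e}$ is regular closed if $\mathbf{a}=\mathrm{cl}(\mathrm{int}(\mathbf{a}))$. $\mathrm{Reg}(\mathbf{e})$ is the set of regular closed subsets ordered by inclusion; it is a complete lattice with $\bigvee_i\mathbf{a}_i=\mathrm{cl}(\bigcup_i\mathbf{a}_i)$ and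 $\bigwedge_i\mathbf{a}_i=\mathrm{cl}(\mathrm{int}(\bigcap_i\mathbf{a}_i))$ (clopen sets are regular closed). A lattice $L$ with least element $0$ is pseudocomplemented if for each $x$ the set $\{y: x\wedge y=0\}$ has a greatest element; it is meet-semidistributive if $x\wedge z=y\wedge z$ implies $x\wedge z=(x\vee y)\wedge z$. -}

module Defs where

open import Level using (Level; _⊔_) renaming (suc to lsuc; zero to lzero)
open import Data.Product using (Σ; Σ-syntax; _×_; _,_)
open import Data.Sum using (_⊎_)
open import Data.Empty using (⊥)
open import Relation.Nullary using (¬_)
open import Relation.Binary.PropositionalEquality using (_≡_)

-- A relation on E viewed as a set of ordered pairs: (x , y) ∈ r  iff  r x y.
PairSet : ∀ {a} → Set a → (ℓ : Level) → Set (a ⊔ lsuc ℓ)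
PairSet E ℓ = E → E → Set ℓ

module _ {a : Level} {E : Set a} where

  _⊆_ : ∀ {ℓ₁ ℓ₂} → PairSet E ℓ₁ → PairSet E ℓ₂ → Set (a ⊔ ℓ₁ ⊔ ℓ₂)
  r ⊆ s = ∀ x y → r x y → s x y

  _≐_ : ∀ {ℓ₁ ℓ₂} → PairSet E ℓ₁ → PairSet E ℓ₂ → Set (a ⊔ ℓ₁ ⊔ ℓ₂)
  r ≐ s = (r ⊆ s) × (s ⊆ r)

  IsEmpty : ∀ {ℓ} → PairSet E ℓ → Set (a ⊔ ℓ)
  IsEmpty r = ∀ x y → ¬ r x y

  NonEmpty : ∀ {ℓ} → PairSet E ℓ → Set (a ⊔ ℓ)
  NonEmpty r = Σ E λ x → Σ E λ y → r x y

  _∩_ : ∀ {ℓ₁ ℓ₂} → PairSet E ℓ₁ → PairSet E ℓ₂ → PairSet E (ℓ₁ ⊔ ℓ₂)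
  (r ∩ s) x y = r x y × s x y

  _∪_ : ∀ {ℓ₁ ℓ₂} → PairSet E ℓ₁ → PairSet E ℓ₂ → PairSet E (ℓ₁ ⊔ ℓ₂)
  (r ∪ s) x y = r x y ⊎ s x y

  _∖_ : ∀ {ℓ₁ ℓ₂} → PairSet E ℓ₁ → PairSet E ℓ₂ → PairSet E (ℓ₁ ⊔ ℓ₂)
  (r ∖ s) x y = r x y × ¬ s x y

  IsTransitive : ∀ {ℓ} → PairSet E ℓ → Set (a ⊔ ℓ)
  IsTransitive r = ∀ x y z → r x y → r y z → r x z

  data cl {ℓ} (r : PairSet E ℓ) : PairSet E (a ⊔ ℓ) where
    step  : ∀ {x y} → r x y → cl r x y
    trans : ∀ {x y z} → cl r x y → cl r y z → cl r x z

module Rel {E : Set} (e : PairSet E lzero) where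

  _◁_ : E → E → Set
  x ◁ y = e x y

  _⊴_ : E → E → Set
  x ⊴ y = x ◁ y ⊎ x ≡ y

  _≡ₑ_ : E → E → Set
  x ≡ₑ y = (x ⊴ y) × (y ⊴ x)

  IsClosed : ∀ {ℓ} → PairSet E ℓ → Set ℓ
  IsClosed r = (r ⊆ e) × IsTransitive r

  IsOpen : ∀ {ℓ} → PairSet E ℓ → Set ℓ
  IsOpen r = (r ⊆ e) × IsTransitive (e ∖ r)

  IsClopen : ∀ {ℓ} → PairSet E ℓ → Set ℓ
  IsClopen r = IsClosed r × IsOpen r

  int : ∀ {ℓ} → PairSet E ℓ → PairSet E (lsuc ℓ)
  int {ℓ} r x y = Σ (PairSet E ℓ) λ s → IsOpen s × (s ⊆ r) × s x y

  IsRegularClosed : PairSet E lzero → Set₁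
  IsRegularClosed r = (r ⊆ e) × (r ≐ cl (int r))

  _∧ᴿ_ : PairSet E lzero → PairSet E lzero → PairSet E (lsuc lzero)
  r ∧ᴿ s = cl (int (r ∩ s))

  _∨ᴿ_ : PairSet E lzero → PairSet E lzero → PairSet E lzero
  r ∨ᴿ s = cl (r ∪ s)

  MeetSemidistributive : Set₁
  MeetSemidistributive =
    ∀ (x y z : PairSet E lzero) → IsRegularClosed x → IsRegularClosed y → IsRegularClosed z →
    (x ∧ᴿ z) ≐ (y ∧ᴿ z) → (x ∧ᴿ z) ≐ ((x ∨ᴿ y) ∧ᴿ z)

  -- Reg(e) is pseudocomplemented (its least element is ∅)
  Pseudocomplemented : Set₁
  Pseudocomplemented =
    ∀ (x : PairSet E lzero) → IsRegularClosed x →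
    Σ (PairSet E lzero) λ y → IsRegularClosed y × IsEmpty (x ∧ᴿ y) ×
      (∀ (w : PairSet E lzero) → IsRegularClosed w → IsEmpty (x ∧ᴿ w) → w ⊆ y)

module Submission where

-- For a predicate T on E, the pairs of e entering T,
--   Into T = {(x , y) ∈ e | x ∉ T, y ∈ T},
-- and the pairs leaving T, OutOf T, are clopen: both are special "cuts" of e.
-- If b ◁ a₀ we take A₀ = Into {a₀}, A₁ = Into {a₁}, C = Into {a₀ , a₁}; if
-- a₀ ◁ b we take the corresponding OutOf sets.  Then C ⊆ A₀ ∪ A₁, and C is
-- nonempty because it contains (b , a₀) resp. (a₀ , b).  The meets Aᵢ ∧ C are
-- empty because Aᵢ ∩ C has empty interior: every pair in it is split by the
-- other element a₁₋ᵢ (which is ≡-equivalent to aᵢ) into two pairs outside of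
-- it, and complements of open sets are transitive.
-- Finally, any such triple of clopen sets refutes meet-semidistributivity
-- (A₀ ∧ C = A₁ ∧ C = ∅ but (A₀ ∨ A₁) ∧ C ⊇ C) and pseudocomplementation (the
-- pseudocomplement of C would contain A₀ and A₁, hence A₀ ∨ A₁ ⊇ C).

open import Defs
open import Level using (Level; 0ℓ)
open import Function using (_∘_)
open import Data.Product using (Σ; _×_; _,_; proj₁; proj₂)
open import Data.Sum using (_⊎_; inj₁; inj₂; [_,_])
open import Data.Empty using (⊥-elim)
open import Relation.Nullary using (¬_)
open import Relation.Binary.PropositionalEquality using (_≡_; _≢_; refl; sym)

module TransitiveClosure {a : Level} {E : Set a} where

  cl-least : ∀ {ℓ ℓ′} {r : PairSet E ℓ} {t : PairSet E ℓ′} →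
    r ⊆ t → IsTransitive t → cl r ⊆ t
  cl-least r⊆t t-trans x y (step rxy) = r⊆t x y rxy
  cl-least r⊆t t-trans x z (trans {y = y} p q) =
    t-trans x y z (cl-least r⊆t t-trans x y p) (cl-least r⊆t t-trans y z q)

  cl-empty : ∀ {ℓ} {r : PairSet E ℓ} → IsEmpty r → IsEmpty (cl r)
  cl-empty r-empty x y (step rxy) = r-empty x y rxy
  cl-empty r-empty x z (trans p q) = cl-empty r-empty _ _ p

  cl-mono : ∀ {ℓ} {r s : PairSet E ℓ} → r ⊆ s → cl r ⊆ cl s
  cl-mono r⊆s = cl-least (λ x y → step ∘ r⊆s x y) (λ _ _ _ → trans)

open TransitiveClosure

module Interior {E : Set} (e : PairSet E 0ℓ) where
  open Rel e

  int-⊆ : ∀ {ℓ} {r : PairSet E ℓ} → int r ⊆ r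
  int-⊆ x y (s , _ , s⊆r , sxy) = s⊆r x y sxy

  open⇒⊆int : ∀ {ℓ} {r s : PairSet E ℓ} → IsOpen s → s ⊆ r → s ⊆ int r
  open⇒⊆int {s = s} s-open s⊆r x y sxy = s , s-open , s⊆r , sxy

  int-mono : ∀ {r s : PairSet E 0ℓ} → r ⊆ s → int r ⊆ int s
  int-mono r⊆s x y (t , t-open , t⊆r , txy) = t , t-open , (λ u v → r⊆s u v ∘ t⊆r u v) , txy

  -- A relation has empty interior if each of its pairs x ◁ y has a splitting
  -- point x ◁ z ◁ y with (x , z) and (z , y) outside it: an open subset
  -- containing (x , y) would have to contain one of them.
  split⇒int-empty : ∀ {ℓ} (r : PairSet E ℓ) →
    (∀ x y → r x y → Σ E λ z → x ◁ z × z ◁ y × ¬ r x z × ¬ r z y) →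
    IsEmpty (int r)
  split⇒int-empty r split x y (s , (_ , co-trans) , s⊆r , sxy)
    with split x y (s⊆r x y sxy)
  ... | z , x◁z , z◁y , ¬rxz , ¬rzy =
    proj₂ (co-trans x z y (x◁z , ¬rxz ∘ s⊆r x z) (z◁y , ¬rzy ∘ s⊆r z y)) sxy

  clopen⇒regular : ∀ r → IsClopen r → IsRegularClosed r
  clopen⇒regular r ((r⊆e , r-trans) , r-open) =
    r⊆e , (λ x y → step ∘ open⇒⊆int r-open (λ _ _ p → p) x y) , cl-least int-⊆ r-trans

  regular⇒transitive : ∀ r → IsRegularClosed r → IsTransitive r
  regular⇒transitive r (_ , r⊆clint , clint⊆r) x y z p q =
    clint⊆r x z (trans (r⊆clint x y p) (r⊆clint y z q))

  -- The meet of Reg(e) is commutative (one inclusion suffices by symmetry).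
  ∧ᴿ-comm : ∀ r s → (r ∧ᴿ s) ⊆ (s ∧ᴿ r)
  ∧ᴿ-comm r s = cl-mono (int-mono (λ _ _ (p , q) → q , p))

module SeparatingTriple {E : Set} (e : PairSet E 0ℓ) where
  open Rel e
  open Interior e

  Separating : PairSet E 0ℓ → PairSet E 0ℓ → PairSet E 0ℓ → Set₁
  Separating A₀ A₁ C = IsClopen A₀ × IsClopen A₁ × IsClopen C ×
    IsEmpty (A₀ ∧ᴿ C) × IsEmpty (A₁ ∧ᴿ C) × NonEmpty C × (C ⊆ (A₀ ∨ᴿ A₁))

  open-⊆-meet : ∀ r C → IsOpen C → C ⊆ r → C ⊆ (r ∧ᴿ C)
  open-⊆-meet r C C-open C⊆r x y Cxy =
    step (open⇒⊆int C-open (λ u v Cuv → C⊆r u v Cuv , Cuv) x y Cxy)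

  -- A₀ ∧ C = A₁ ∧ C = ∅, yet (A₀ ∨ A₁) ∧ C contains C ≠ ∅.
  separating⇒¬semidistributive : ∀ {A₀ A₁ C} → Separating A₀ A₁ C → ¬ MeetSemidistributive
  separating⇒¬semidistributive {A₀} {A₁} {C}
      (A₀-clopen , A₁-clopen , C-clopen , A₀∧C-empty , A₁∧C-empty , (x , y , Cxy) , C⊆A₀∨A₁) msd =
    A₀∧C-empty x y (proj₂ meets-agree x y (open-⊆-meet (A₀ ∨ᴿ A₁) C (proj₂ C-clopen) C⊆A₀∨A₁ x y Cxy))
    where
    meets-agree : (A₀ ∧ᴿ C) ≐ ((A₀ ∨ᴿ A₁) ∧ᴿ C)
    meets-agree = msd A₀ A₁ C (clopen⇒regular A₀ A₀-clopen) (clopen⇒regular A₁ A₁-clopen)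
      (clopen⇒regular C C-clopen)
      ((λ u v p → ⊥-elim (A₀∧C-empty u v p)) , (λ u v p → ⊥-elim (A₁∧C-empty u v p)))

  -- The pseudocomplement C* of C would contain A₀ and A₁, hence A₀ ∨ A₁ ⊇ C,
  -- so C ∧ C* ⊇ C ≠ ∅.
  separating⇒¬pseudocomplemented : ∀ {A₀ A₁ C} → Separating A₀ A₁ C → ¬ Pseudocomplemented
  separating⇒¬pseudocomplemented {A₀} {A₁} {C}
      (A₀-clopen , A₁-clopen , C-clopen , A₀∧C-empty , A₁∧C-empty , (x , y , Cxy) , C⊆A₀∨A₁) pc
    with pc C (clopen⇒regular C C-clopen)
  ... | C* , C*-regular , C∧C*-empty , C*-greatest =
    C∧C*-empty x y (∧ᴿ-comm C* C x y (open-⊆-meet C* C (proj₂ C-clopen) C⊆C* x y Cxy))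
    where
    A⊆C* : ∀ {A} → IsClopen A → IsEmpty (A ∧ᴿ C) → A ⊆ C*
    A⊆C* {A} A-clopen A∧C-empty = C*-greatest A (clopen⇒regular A A-clopen)
      (λ u v p → A∧C-empty u v (∧ᴿ-comm C A u v p))

    C⊆C* : C ⊆ C*
    C⊆C* u v Cuv = cl-least (λ p q → λ { (inj₁ a) → A⊆C* A₀-clopen A₀∧C-empty p q a
                                        ; (inj₂ a) → A⊆C* A₁-clopen A₁∧C-empty p q a })
                            (regular⇒transitive C* C*-regular) u v (C⊆A₀∨A₁ u v Cuv)

  HasSeparatingTriple : Set₁
  HasSeparatingTriple = Σ (PairSet E 0ℓ) λ A₀ → Σ (PairSet E 0ℓ) λ A₁ → Σ (PairSet E 0ℓ) λ C →
    Separating A₀ A₁ C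

  consequences : HasSeparatingTriple →
    HasSeparatingTriple × ¬ MeetSemidistributive × ¬ Pseudocomplemented
  consequences triple@(_ , _ , _ , separating) =
    triple , separating⇒¬semidistributive separating , separating⇒¬pseudocomplemented separating

module Cuts {E : Set} (e : PairSet E 0ℓ) (e-trans : IsTransitive e) where
  open Rel e
  open Interior e
  open SeparatingTriple e

  Cut : (E → Set) → (E → Set) → PairSet E 0ℓ
  Cut S T x y = x ◁ y × S x × T y

  -- If S and T are disjoint the cut is transitive; if moreover every point
  -- lies (not-not) in S or T, its complement in e is transitive too.
  cut-clopen : (S T : E → Set) → (∀ x → S x → ¬ T x) → (∀ x → ¬ S x → ¬ ¬ T x) →
    IsClopen (Cut S T)
  cut-clopen S T disjoint covering =
    ((λ _ _ → proj₁) , λ { _ y _ (_ , _ , Ty) (_ , Sy , _) → ⊥-elim (disjoint y Sy Ty) })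
    , ((λ _ _ → proj₁) , λ { x y z (x◁y , ¬cut-xy) (y◁z , ¬cut-yz) →
        e-trans x y z x◁y y◁z ,
        λ { (_ , Sx , Tz) → covering y (λ Sy → ¬cut-yz (y◁z , Sy , Tz))
                                       (λ Ty → ¬cut-xy (x◁y , Sx , Ty)) } })

  Into OutOf : (E → Set) → PairSet E 0ℓ
  Into T  = Cut (λ x → ¬ T x) T
  OutOf T = Cut T (λ x → ¬ T x)

  into-clopen : ∀ T → IsClopen (Into T)
  into-clopen T = cut-clopen _ T (λ _ ¬t t → ¬t t) (λ _ ¬¬t ¬t → ¬¬t ¬t)

  outOf-clopen : ∀ T → IsClopen (OutOf T)
  outOf-clopen T = cut-clopen T _ (λ _ t ¬t → ¬t t) (λ _ ¬t ¬¬t → ¬¬t ¬t)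

  into-∪ : ∀ S T → Into (λ y → S y ⊎ T y) ⊆ (Into S ∪ Into T)
  into-∪ S T x y (x◁y , ¬S⊎T , inj₁ Sy) = inj₁ (x◁y , ¬S⊎T ∘ inj₁ , Sy)
  into-∪ S T x y (x◁y , ¬S⊎T , inj₂ Ty) = inj₂ (x◁y , ¬S⊎T ∘ inj₂ , Ty)

  outOf-∪ : ∀ S T → OutOf (λ y → S y ⊎ T y) ⊆ (OutOf S ∪ OutOf T)
  outOf-∪ S T x y (x◁y , inj₁ Sx , ¬S⊎T) = inj₁ (x◁y , Sx , ¬S⊎T ∘ inj₁)
  outOf-∪ S T x y (x◁y , inj₂ Tx , ¬S⊎T) = inj₂ (x◁y , Tx , ¬S⊎T ∘ inj₂)

  -- If q ≠ p is ≡ₑ-equivalent to p and lies in T, the pairs entering both {p}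
  -- and T have empty interior: (x , p) is split by q.
  into-meet-empty : ∀ p q → p ≢ q → p ◁ q → q ◁ p → (T : E → Set) → T q →
    IsEmpty (Into (_≡ p) ∧ᴿ Into T)
  into-meet-empty p q p≢q p◁q q◁p T Tq = cl-empty (split⇒int-empty _ split)
    where
    split : ∀ x y → (Into (_≡ p) ∩ Into T) x y →
      Σ E λ z → x ◁ z × z ◁ y × ¬ (Into (_≡ p) ∩ Into T) x z × ¬ (Into (_≡ p) ∩ Into T) z y
    split x .p ((x◁p , _ , refl) , _) =
      q , e-trans x p q x◁p p◁q , q◁p ,
      (λ { ((_ , _ , q≡p) , _) → p≢q (sym q≡p) }) , (λ { (_ , _ , ¬Tq , _) → ¬Tq Tq })

  -- The dual statement for pairs leaving {p} and T: (p , y) is split by q.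
  outOf-meet-empty : ∀ p q → p ≢ q → p ◁ q → q ◁ p → (T : E → Set) → T q →
    IsEmpty (OutOf (_≡ p) ∧ᴿ OutOf T)
  outOf-meet-empty p q p≢q p◁q q◁p T Tq = cl-empty (split⇒int-empty _ split)
    where
    split : ∀ x y → (OutOf (_≡ p) ∩ OutOf T) x y →
      Σ E λ z → x ◁ z × z ◁ y × ¬ (OutOf (_≡ p) ∩ OutOf T) x z × ¬ (OutOf (_≡ p) ∩ OutOf T) z y
    split .p y ((p◁y , refl , _) , _) =
      q , p◁q , e-trans q p y q◁p p◁y ,
      (λ { (_ , _ , _ , ¬Tq) → ¬Tq Tq }) , (λ { ((_ , q≡p , _) , _) → p≢q (sym q≡p) })

  OneOf : E → E → E → Set
  OneOf a₀ a₁ y = y ≡ a₀ ⊎ y ≡ a₁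

  entering-triple : ∀ a₀ a₁ b → a₀ ≢ a₁ → a₀ ◁ a₁ → a₁ ◁ a₀ → ¬ OneOf a₀ a₁ b → b ◁ a₀ →
    HasSeparatingTriple
  entering-triple a₀ a₁ b a₀≢a₁ a₀◁a₁ a₁◁a₀ b∉a₀a₁ b◁a₀ =
    Into (_≡ a₀) , Into (_≡ a₁) , Into (OneOf a₀ a₁) ,
    into-clopen _ , into-clopen _ , into-clopen _ ,
    into-meet-empty a₀ a₁ a₀≢a₁ a₀◁a₁ a₁◁a₀ _ (inj₂ refl) ,
    into-meet-empty a₁ a₀ (a₀≢a₁ ∘ sym) a₁◁a₀ a₀◁a₁ _ (inj₁ refl) ,
    (b , a₀ , b◁a₀ , b∉a₀a₁ , inj₁ refl) , (λ x y → step ∘ into-∪ _ _ x y)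

  leaving-triple : ∀ a₀ a₁ b → a₀ ≢ a₁ → a₀ ◁ a₁ → a₁ ◁ a₀ → ¬ OneOf a₀ a₁ b → a₀ ◁ b →
    HasSeparatingTriple
  leaving-triple a₀ a₁ b a₀≢a₁ a₀◁a₁ a₁◁a₀ b∉a₀a₁ a₀◁b =
    OutOf (_≡ a₀) , OutOf (_≡ a₁) , OutOf (OneOf a₀ a₁) ,
    outOf-clopen _ , outOf-clopen _ , outOf-clopen _ ,
    outOf-meet-empty a₀ a₁ a₀≢a₁ a₀◁a₁ a₁◁a₀ _ (inj₂ refl) ,
    outOf-meet-empty a₁ a₀ (a₀≢a₁ ∘ sym) a₁◁a₀ a₀◁a₁ _ (inj₁ refl) ,
    (a₀ , b , a₀◁b , inj₁ refl , b∉a₀a₁) , (λ x y → step ∘ outOf-∪ _ _ x y)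

  ⊴-distinct : ∀ {x y} → x ⊴ y → x ≢ y → x ◁ y
  ⊴-distinct (inj₁ x◁y) _   = x◁y
  ⊴-distinct (inj₂ x≡y) x≢y = ⊥-elim (x≢y x≡y)

proposition3p5 : {E : Set} (e : PairSet E 0ℓ) → IsTransitive e →
    (a₀ a₁ b : E) → a₀ ≢ a₁ → a₀ ≢ b → a₁ ≢ b →
    Rel._≡ₑ_ e a₀ a₁ → (Rel._◁_ e b a₀ ⊎ Rel._◁_ e a₀ b) →
    (Σ (PairSet E 0ℓ) λ A₀ → Σ (PairSet E 0ℓ) λ A₁ → Σ (PairSet E 0ℓ) λ C →
      Rel.IsClopen e A₀ × Rel.IsClopen e A₁ × Rel.IsClopen e C ×
      IsEmpty (Rel._∧ᴿ_ e A₀ C) × IsEmpty (Rel._∧ᴿ_ e A₁ C) ×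
      NonEmpty C × (C ⊆ Rel._∨ᴿ_ e A₀ A₁))
    × ¬ Rel.MeetSemidistributive e × ¬ Rel.Pseudocomplemented e
proposition3p5 e e-trans a₀ a₁ b a₀≢a₁ a₀≢b a₁≢b (a₀⊴a₁ , a₁⊴a₀) b-comparable =
  consequences triple
  where
  open Rel e
  open Cuts e e-trans
  open SeparatingTriple e

  a₀◁a₁ : a₀ ◁ a₁
  a₀◁a₁ = ⊴-distinct a₀⊴a₁ a₀≢a₁

  a₁◁a₀ : a₁ ◁ a₀
  a₁◁a₀ = ⊴-distinct a₁⊴a₀ (a₀≢a₁ ∘ sym)

  b∉a₀a₁ : ¬ OneOf a₀ a₁ b
  b∉a₀a₁ = [ a₀≢b ∘ sym , a₁≢b ∘ sym ]

  triple : HasSeparatingTriple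
  triple = [ entering-triple a₀ a₁ b a₀≢a₁ a₀◁a₁ a₁◁a₀ b∉a₀a₁
           , leaving-triple  a₀ a₁ b a₀≢a₁ a₀◁a₁ a₁◁a₀ b∉a₀a₁ ] b-comparable
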